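{- Let $M$ and $N$ be matroids and let $f: M \rightarrow N$ be a matroid homomorphism such that $f^{ -1}(x)$ is a series class of $M$ for each $x \in E(N)$. Then $\mathcal{C}' := \{ f(C) \mid C \in \mathcal{C}(M)\}$ is the set of circuits of a matroid $H$ on the ground set $E(N)$, and $f^{ -1}(C') \in \mathcal{C}(M)$ for every $C' \in \mathcal{C}' = \mathcal{C}(H)$; that is, the map $f: E(M) \rightarrow E(N) = E(H)$ is a matroid homeomorphism from $M$ onto $H$.
   Context: For a matroid $X$, $E(X)$ denotes its ground set and $\mathcal{C}(X)$ its set of circuits. A matroid homomorphism $f: M \rightarrow N$ is a map $f: E(M) \rightarrow E(N)$ from the ground set of $M$ onto the ground set of $N$ such that $f(C) \in \mathcal{C}(N)$ for every $C \in \mathcal{C}(M)$. A homomorphism $f: M \rightarrow N$ is a homeomorphism if in addition $f^{ -1}(D) \in \mathcal{C}(M)$ for every $D \in \mathcal{C}(N)$. A set $S \subseteq E(M)$ is called a series class of $M$ if its elements are pairwise in series, i.e., every circuit of $M$ that meets $S$ contains $S$. -}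

module Defs where

open import Data.Nat using (ℕ)
open import Data.Fin using (Fin; _≟_)
open import Data.Fin.Subset using (Subset; _∈_; _∉_; _⊆_; _∪_; ⊥; ⁅_⁆)
open import Data.Fin.Subset.Properties using (_∈?_)
open import Data.Fin.Properties using (any?)
open import Data.Vec using (tabulate; lookup)
open import Data.Product using (Σ; ∃; _×_; _,_)
open import Relation.Nullary using (¬_)
open import Relation.Nullary.Decidable using (⌊_⌋; _×-dec_)
open import Relation.Binary.PropositionalEquality using (_≡_; _≢_)
open import Function using (Surjective)

record Matroid (n : ℕ) : Set₁ where
  field
    IsCircuit   : Subset n → Set
    empty-not   : ¬ IsCircuit ⊥
    incomparable : ∀ {C D} → IsCircuit C → IsCircuit D → C ⊆ D → C ≡ D
    elimination : ∀ {C D x} → IsCircuit C → IsCircuit D → C ≢ D →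
                  x ∈ C → x ∈ D →
                  ∃ λ E → IsCircuit E × E ⊆ (C ∪ D) × x ∉ E
open Matroid public

image : ∀ {m n} → (Fin m → Fin n) → Subset m → Subset n
image f C = tabulate λ y → ⌊ any? (λ x → (x ∈? C) ×-dec (f x ≟ y)) ⌋

preimage : ∀ {m n} → (Fin m → Fin n) → Subset n → Subset m
preimage f D = tabulate λ x → lookup D (f x)

Onto : ∀ {m n} → (Fin m → Fin n) → Set
Onto {m} {n} f = ∀ (y : Fin n) → ∃ λ (x : Fin m) → f x ≡ y

record IsHomomorphism {m n} (f : Fin m → Fin n) (M : Matroid m) (N : Matroid n) : Set where
  field
    onto : Onto f
    circuit-image : ∀ C → IsCircuit M C → IsCircuit N (image f C)

record IsHomeomorphism {m n} (f : Fin m → Fin n) (M : Matroid m) (N : Matroid n) : Set where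
  field
    homomorphism : IsHomomorphism f M N
    circuit-preimage : ∀ D → IsCircuit N D → IsCircuit M (preimage f D)

IsSeriesClass : ∀ {m} → Matroid m → Subset m → Set
IsSeriesClass M S = ∀ C → IsCircuit M C → (∃ λ x → x ∈ S × x ∈ C) → S ⊆ C

module Submission where

-- Call a set C ⊆ E(M) saturated for f when it is a union of
-- fibres of f, i.e. x ∈ C whenever f x = f c for some c ∈ C.  If every
-- fibre f⁻¹(y) is a series class, every circuit of M meeting a fibre
-- contains it, so every circuit is saturated.  For a saturated C one has
-- f⁻¹(f(C)) = C, i.e. "x ∈ C" can be read off from "f x ∈ f(C)".
--
-- Finally f : M → H is a homeomorphism because f⁻¹(f(C)) = C.

open import Defs
open import Data.Nat using (ℕ)
open import Data.Fin using (Fin; _≟_)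
open import Data.Fin.Subset using (Subset; ⁅_⁆; _∈_; _∉_; _⊆_; _∪_; ⊥)
open import Data.Fin.Subset.Properties using (_∈?_; x∈⁅x⁆; ⊆-antisym; p⊆p∪q; q⊆p∪q; x∈p∪q⁻)
open import Data.Fin.Properties using (any?)
open import Data.Vec using (tabulate; lookup)
open import Data.Vec.Properties using (lookup∘tabulate; []=⇒lookup; lookup⇒[]=)
open import Data.Bool using (true)
open import Data.Product using (Σ; ∃; _×_; _,_)
open import Data.Sum using (inj₁; inj₂)
open import Data.Empty using (⊥-elim)
open import Relation.Nullary using (yes; no; ¬_)
open import Relation.Nullary.Decidable using (⌊_⌋; _×-dec_)
open import Relation.Binary.PropositionalEquality using (_≡_; refl; sym; trans; cong; subst; _≢_)
open import Function.Bundles using (_⇔_; mk⇔)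

module _ {m n : ℕ} (f : Fin m → Fin n) where

  image-elim : ∀ {C y} → y ∈ image f C → ∃ λ c → c ∈ C × f c ≡ y
  image-elim {C} {y} y∈fC
    with trans (sym (lookup∘tabulate _ y)) ([]=⇒lookup y∈fC)
  ... | decided-true with any? (λ x → (x ∈? C) ×-dec (f x ≟ y))
  ... | yes (c , c∈C , fc≡y) = c , c∈C , fc≡y
  ... | no _ with decided-true
  ...          | ()

  image-intro : ∀ {C c} → c ∈ C → f c ∈ image f C
  image-intro {C} {c} c∈C =
    lookup⇒[]= (f c) (image f C) (trans (lookup∘tabulate _ (f c)) witnessed)
    where
    witnessed : ⌊ any? (λ x → (x ∈? C) ×-dec (f x ≟ f c)) ⌋ ≡ true
    witnessed with any? (λ x → (x ∈? C) ×-dec (f x ≟ f c))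
    ... | yes _ = refl
    ... | no none = ⊥-elim (none (c , c∈C , refl))

  image-⊆-∪ : ∀ {F C D} → F ⊆ C ∪ D → image f F ⊆ image f C ∪ image f D
  image-⊆-∪ {F} {C} {D} F⊆C∪D y∈fF with image-elim y∈fF
  ... | e , e∈F , refl with x∈p∪q⁻ C D (F⊆C∪D e∈F)
  ... | inj₁ e∈C = p⊆p∪q (image f D) (image-intro e∈C)
  ... | inj₂ e∈D = q⊆p∪q (image f C) (image f D) (image-intro e∈D)

  preimage-elim : ∀ {D x} → x ∈ preimage f D → f x ∈ D
  preimage-elim {D} {x} x∈ =
    lookup⇒[]= (f x) D (trans (sym (lookup∘tabulate _ x)) ([]=⇒lookup x∈))

  preimage-intro : ∀ {D x} → f x ∈ D → x ∈ preimage f D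
  preimage-intro {D} {x} fx∈D =
    lookup⇒[]= x (preimage f D) (trans (lookup∘tabulate _ x) ([]=⇒lookup fx∈D))

  Saturated : Subset m → Set
  Saturated C = ∀ {c x} → c ∈ C → f x ≡ f c → x ∈ C

  saturated-reflect : ∀ {C x} → Saturated C → f x ∈ image f C → x ∈ C
  saturated-reflect sat fx∈fC with image-elim fx∈fC
  ... | c , c∈C , fc≡fx = sat c∈C (sym fc≡fx)

  preimage-image : ∀ {C} → Saturated C → preimage f (image f C) ≡ C
  preimage-image sat =
    ⊆-antisym (λ x∈ → saturated-reflect sat (preimage-elim x∈))
              (λ x∈C → preimage-intro (image-intro x∈C))

circuit-saturated : ∀ {m n} (M : Matroid m) (f : Fin m → Fin n) →
  (∀ y → IsSeriesClass M (preimage f ⁅ y ⁆)) →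
  ∀ {C} → IsCircuit M C → Saturated f C
circuit-saturated M f series {C} C-circ {c} {x} c∈C fx≡fc =
  series (f c) C C-circ (c , in-fibre refl , c∈C) (in-fibre fx≡fc)
  where
  in-fibre : ∀ {z} → f z ≡ f c → z ∈ preimage f ⁅ f c ⁆
  in-fibre fz≡fc = preimage-intro f (subst (_∈ ⁅ f c ⁆) (sym fz≡fc) (x∈⁅x⁆ (f c)))

ImageCircuit : ∀ {m n} → Matroid m → (Fin m → Fin n) → Subset n → Set
ImageCircuit M f D = ∃ λ C → IsCircuit M C × image f C ≡ D

imageMatroid : ∀ {m n} (M : Matroid m) (N : Matroid n) (f : Fin m → Fin n) →
  (∀ C → IsCircuit M C → IsCircuit N (image f C)) →
  (∀ {C} → IsCircuit M C → Saturated f C) →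
  Matroid n
imageMatroid M N f circuit-image saturated = record
  { IsCircuit    = ImageCircuit M f
  ; empty-not    = empty-not′
  ; incomparable = incomparable′
  ; elimination  = elimination′
  }
  where
  empty-not′ : ¬ ImageCircuit M f ⊥
  empty-not′ (C , C-circ , fC≡⊥) =
    empty-not N (subst (IsCircuit N) fC≡⊥ (circuit-image C C-circ))

  incomparable′ : ∀ {C D} → ImageCircuit M f C → ImageCircuit M f D → C ⊆ D → C ≡ D
  incomparable′ (C , C-circ , refl) (D , D-circ , refl) =
    incomparable N (circuit-image C C-circ) (circuit-image D D-circ)

  -- (C3): pull the common element back to c ∈ C ∩ D, eliminate c in M, and
  -- push the resulting circuit forward; f c stays out of it by saturation.
  elimination′ : ∀ {C D y} → ImageCircuit M f C → ImageCircuit M f D → C ≢ D →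
                 y ∈ C → y ∈ D →
                 ∃ λ F → ImageCircuit M f F × F ⊆ C ∪ D × y ∉ F
  elimination′ (C , C-circ , refl) (D , D-circ , refl) fC≢fD y∈fC y∈fD
    with image-elim f y∈fC
  ... | c , c∈C , refl
    with elimination M C-circ D-circ (λ C≡D → fC≢fD (cong (image f) C≡D))
                     c∈C (saturated-reflect f (saturated D-circ) y∈fD)
  ... | F , F-circ , F⊆C∪D , c∉F =
    image f F , (F , F-circ , refl) , image-⊆-∪ f F⊆C∪D ,
    (λ fc∈fF → c∉F (saturated-reflect f (saturated F-circ) fc∈fF))

theorem2 : ∀ {m n} (M : Matroid m) (N : Matroid n) (f : Fin m → Fin n) →
    IsHomomorphism f M N →
    (∀ (y : Fin n) → IsSeriesClass M (preimage f ⁅ y ⁆)) →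
    Σ (Matroid n) λ H →
    (∀ (D : Subset n) → IsCircuit H D ⇔ (∃ λ C → IsCircuit M C × image f C ≡ D))
    × IsHomeomorphism f M H
theorem2 M N f hom series =
  H , (λ D → mk⇔ (λ D-circ → D-circ) (λ D-circ → D-circ)) , homeomorphism
  where
  open IsHomomorphism hom

  saturated : ∀ {C} → IsCircuit M C → Saturated f C
  saturated = circuit-saturated M f series

  H : Matroid _
  H = imageMatroid M N f circuit-image saturated

  homeomorphism : IsHomeomorphism f M H
  homeomorphism = record
    { homomorphism     = record { onto = onto ; circuit-image = λ C C-circ → C , C-circ , refl }
    ; circuit-preimage = λ { D (C , C-circ , refl) →
        subst (IsCircuit M) (sym (preimage-image f (saturated C-circ))) C-circ }
    }
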